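{- Let $G$ be a finite simple graph of order $n_G$ and $H$ a finite simple graph of order $n_H$. Then \[\mathrm{C}(G\cdot H;x)=\mathrm{C}\left(G;(x+1)^{n_H}-1\right)+n_G\left[\mathrm{C}(H;x)-(x+1)^{n_H}+1\right].\] In particular, for every $n\geq 1$, $\mathrm{C}(G\cdot K_n;x)=\mathrm{C}(G;(x+1)^n-1)$, where $K_n$ is the complete graph on $n$ nodes.
   Context: For a finite simple undirected graph $G$ with $n$ nodes, a connected set of $G$ is a nonempty subset of nodes inducing a connected subgraph, and $c_k$ denotes the number of connected sets of $G$ of order $k$. The connected set polynomial of $G$ is $\mathrm{C}(G;x)=\sum_{k=1}^n c_k x^k$. The lexicographic product $G\cdot H$ is the graph on node set $V(G)\times V(H)$ in which $(u,x)$ and $(v,y)$ are adjacent if and only if either $u$ is adjacent to $v$ in $G$, or $u=v$ and $x$ is adjacent to $y$ in $H$. -}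

module Defs where

open import Data.Nat using (ℕ)
open import Data.Bool using (Bool; true; false; not; _∧_; _∨_)
open import Data.Fin using (Fin; _≟_; remQuot)
open import Data.Fin.Subset using (Subset; _∈_; Nonempty; ∣_∣)
open import Data.Product using (_×_; _,_)
open import Data.List using (List; map; foldr)
open import Data.List.Relation.Unary.Unique.Propositional using (Unique)
import Data.List.Membership.Propositional as L
open import Data.Integer using (ℤ; _^_; _+_; +_)
open import Function.Bundles using (_⇔_)
open import Relation.Binary.PropositionalEquality using (_≡_)
open import Relation.Nullary.Decidable using (⌊_⌋)

Adj : ℕ → Set
Adj n = Fin n → Fin n → Bool

IsSimple : ∀ {n} → Adj n → Set
IsSimple {n} A = (∀ (i j : Fin n) → A i j ≡ A j i) × (∀ (i : Fin n) → A i i ≡ false)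

K : (n : ℕ) → Adj n
K n i j = not ⌊ i ≟ j ⌋

-- Lexicographic product G · H on Fin (nG * nH); a node p encodes the pair remQuot nH p = (u , x).
lex : ∀ {nG nH} → Adj nG → Adj nH → Adj (nG Data.Nat.* nH)
lex {nG} {nH} G H p q with remQuot {nG} nH p | remQuot {nG} nH q
... | (u , x) | (v , y) = G u v ∨ (⌊ u ≟ v ⌋ ∧ H x y)

data Reach {n : ℕ} (A : Adj n) (S : Subset n) (u : Fin n) : Fin n → Set where
  here : u ∈ S → Reach A S u u
  step : ∀ {v w} → Reach A S u v → A v w ≡ true → w ∈ S → Reach A S u w

Connected : ∀ {n} → Adj n → Subset n → Set
Connected {n} A S = Nonempty S × (∀ (u v : Fin n) → u ∈ S → v ∈ S → Reach A S u v)

EnumConnected : ∀ {n} → Adj n → List (Subset n) → Set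
EnumConnected A L = Unique L × (∀ S → (S L.∈ L) ⇔ Connected A S)

-- The connected set polynomial evaluated at x, computed from an enumeration L of the
-- connected sets: sum over connected S of x^|S|  (= sum_k c_k x^k).
CP : ∀ {n} → List (Subset n) → ℤ → ℤ
CP L x = foldr (λ S acc → x ^ ∣ S ∣ + acc) (+ 0) L

-- A node set S of G · H is a family of fibres F u ⊆ V(H), one for each node u of G, and its
-- support T is the set of u with F u nonempty. Nodes over G-adjacent nodes are adjacent, and the
-- last step of a walk between distinct nodes of T is a G-edge; hence if |T| ≠ 1, S is connected
-- iff T is. If T = {u}, every edge inside S is an H-edge of F u, as G has no loops, so S is
-- connected iff F u is. Summing x^|S| over the families with support T gives y^|T| with
-- y = (x + 1)^n_H − 1, which turns the first case into C(G; y); the n_G singleton supports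
-- contribute C(H; x) instead of y each.
module Submission where

-- A separate module because it uses _*_ on ℤ, whereas the type of lemma7 uses _*_ on ℕ.
module ConnectedSetPolynomial where

  open import Defs
  open import Data.Bool as Bool using (Bool; true; false; not; _∨_; _∧_; if_then_else_)
  open import Data.Bool.Properties using (∨-zeroʳ)
  open import Data.Fin using (Fin; zero; suc; _≟_; remQuot; combine)
  open import Data.Fin.Properties using (remQuot-combine; combine-remQuot; suc-injective)
  open import Data.Fin.Subset using (Subset; _∈_; _∉_; Nonempty; ∣_∣; ⊥; outside; inside)
  open import Data.Fin.Subset.Properties using (nonempty?; Empty-unique; ∉⊥; ∣⊥∣≡0; drop-there)
  open import Data.Integer using (ℤ; +_; _+_; _-_; _*_; _^_)
  open import Data.Integer.Properties
    using (+-identityˡ; +-identityʳ; +-assoc; +-comm; *-identityˡ; *-identityʳ; *-zeroʳ; *-comm; *-assoc;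
           *-distribˡ-+; *-distribʳ-+; ^-distribˡ-+-*)
  open import Data.Integer.Tactic.RingSolver using (solve-∀)
  open import Data.List as List using (List; []; _∷_; map; filter; cartesianProductWith; [_])
  open import Data.List.Membership.Propositional using () renaming (_∈_ to _∈ₗ_)
  open import Data.List.Membership.Propositional.Properties
    using (∈-cartesianProductWith⁺; ∈-filter⁺; ∈-filter⁻; ∈-map⁺)
  open import Data.List.Membership.Propositional.Properties.WithK using (unique∧set⇒bag)
  open import Data.List.Relation.Binary.BagAndSetEquality using (∼bag⇒↭)
  open import Data.List.Relation.Binary.Permutation.Propositional as ↭ using (_↭_)
  open import Data.List.Relation.Unary.All using ([]; _∷_)
  open import Data.List.Relation.Unary.Any using (here; there; any?)
  open import Data.List.Relation.Unary.Unique.Propositional using (Unique; []; _∷_)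
  open import Data.List.Relation.Unary.Unique.Propositional.Properties using (cartesianProductWith⁺; filter⁺; map⁺)
  open import Data.Nat as ℕ using (ℕ; zero; suc)
  import Data.Nat.Properties as ℕ
  open import Data.Product using (_×_; _,_; proj₁; proj₂; ∃-syntax)
  open import Data.Sum using (_⊎_; inj₁; inj₂)
  open import Data.Vec as Vec using (Vec; []; _∷_; _++_; here; there; lookup; concat; group)
  open import Data.Vec.Properties
    using (∷-injective; ++-injectiveˡ; ++-injectiveʳ; lookup-concat; lookup-map; []=⇒lookup; lookup⇒[]=; ≡-dec)
  open import Function using (_∘_)
  open import Function.Bundles using (_⇔_; mk⇔; Equivalence)
  open import Level using (Level)
  open import Relation.Binary.PropositionalEquality
    using (_≡_; _≢_; refl; sym; trans; cong; cong₂; subst; subst₂; module ≡-Reasoning)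
  open import Relation.Nullary using (Dec; yes; no; does; proof; ¬_; ¬?; contradiction)
  open import Relation.Nullary.Decidable as Dec using (⌊_⌋; dec-true; dec-false)
  open import Relation.Nullary.Reflects using (Reflects; invert)
  open import Relation.Unary using (Pred; Decidable)

  private variable
    a ℓ : Level
    A B C : Set a
    m n : ℕ

  open ≡-Reasoning

  -- Finite sums over lists

  ∑ : List A → (A → ℤ) → ℤ
  ∑ []       f = + 0
  ∑ (x ∷ xs) f = f x + ∑ xs f

  ∑-cong : ∀ (xs : List A) {f g : A → ℤ} → (∀ x → f x ≡ g x) → ∑ xs f ≡ ∑ xs g
  ∑-cong []       f≗g = refl
  ∑-cong (x ∷ xs) f≗g = cong₂ _+_ (f≗g x) (∑-cong xs f≗g)

  ∑-++ : ∀ (xs ys : List A) f → ∑ (xs List.++ ys) f ≡ ∑ xs f + ∑ ys f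
  ∑-++ []       ys f = sym (+-identityˡ (∑ ys f))
  ∑-++ (x ∷ xs) ys f = trans (cong (_+_ (f x)) (∑-++ xs ys f)) (sym (+-assoc (f x) (∑ xs f) (∑ ys f)))

  ∑-map : ∀ (g : B → A) xs f → ∑ (map g xs) f ≡ ∑ xs (f ∘ g)
  ∑-map g []       f = refl
  ∑-map g (x ∷ xs) f = cong (_+_ (f (g x))) (∑-map g xs f)

  ∑-cartesianProductWith : ∀ (g : A → B → C) xs ys f →
    ∑ (cartesianProductWith g xs ys) f ≡ ∑ xs (λ x → ∑ ys (f ∘ g x))
  ∑-cartesianProductWith g []       ys f = refl
  ∑-cartesianProductWith g (x ∷ xs) ys f =
    trans (∑-++ (map (g x) ys) _ f) (cong₂ _+_ (∑-map (g x) ys f) (∑-cartesianProductWith g xs ys f))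

  ∑-+ : ∀ (xs : List A) f g → ∑ xs (λ x → f x + g x) ≡ ∑ xs f + ∑ xs g
  ∑-+ []       f g = refl
  ∑-+ (x ∷ xs) f g = trans (cong (_+_ (f x + g x)) (∑-+ xs f g)) (interchange (f x) (g x) (∑ xs f) (∑ xs g))
    where
    interchange : ∀ a b c d → a + b + (c + d) ≡ a + c + (b + d)
    interchange = solve-∀

  ∑-*ˡ : ∀ (xs : List A) c f → ∑ xs (λ x → c * f x) ≡ c * ∑ xs f
  ∑-*ˡ []       c f = sym (*-comm c (+ 0))
  ∑-*ˡ (x ∷ xs) c f = trans (cong (_+_ (c * f x)) (∑-*ˡ xs c f)) (sym (*-distribˡ-+ c (f x) (∑ xs f)))

  ∑-*ʳ : ∀ (xs : List A) c f → ∑ xs (λ x → f x * c) ≡ ∑ xs f * c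
  ∑-*ʳ xs c f = trans (∑-cong xs (λ x → *-comm (f x) c)) (trans (∑-*ˡ xs c f) (*-comm c (∑ xs f)))

  ∑-↭ : ∀ {xs ys : List A} f → xs ↭ ys → ∑ xs f ≡ ∑ ys f
  ∑-↭ f ↭.refl                = refl
  ∑-↭ f (↭.prep x xs↭ys)      = cong (_+_ (f x)) (∑-↭ f xs↭ys)
  ∑-↭ f (↭.swap x y xs↭ys)    = trans (cong (λ s → f x + (f y + s)) (∑-↭ f xs↭ys)) (left-comm (f x) (f y) _)
    where
    left-comm : ∀ a b c → a + (b + c) ≡ b + (a + c)
    left-comm = solve-∀
  ∑-↭ f (↭.trans xs↭ys ys↭zs) = trans (∑-↭ f xs↭ys) (∑-↭ f ys↭zs)

  ∑-unique-⇔ : ∀ {xs ys : List A} f → Unique xs → Unique ys → (∀ {x} → x ∈ₗ xs ⇔ x ∈ₗ ys) →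
               ∑ xs f ≡ ∑ ys f
  ∑-unique-⇔ f xs! ys! xs≈ys = ∑-↭ f (∼bag⇒↭ (unique∧set⇒bag xs! ys! xs≈ys))

  𝟙 : {P : Set ℓ} → Dec P → ℤ
  𝟙 P? = if does P? then + 1 else + 0

  𝟙-⇔ : {P Q : Set ℓ} → P ⇔ Q → (P? : Dec P) (Q? : Dec Q) → 𝟙 P? ≡ 𝟙 Q?
  𝟙-⇔ P⇔Q (yes _) (yes _) = refl
  𝟙-⇔ P⇔Q (no _)  (no _)  = refl
  𝟙-⇔ P⇔Q (yes P) (no ¬Q) = contradiction (Equivalence.to P⇔Q P) ¬Q
  𝟙-⇔ P⇔Q (no ¬P) (yes Q) = contradiction (Equivalence.from P⇔Q Q) ¬P

  ∑-filter : ∀ {P : Pred A ℓ} (P? : Decidable P) xs f → ∑ (filter P? xs) f ≡ ∑ xs (λ x → 𝟙 (P? x) * f x)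
  ∑-filter P? []       f = refl
  ∑-filter P? (x ∷ xs) f with P? x
  ... | yes _ = cong₂ _+_ (sym (*-identityˡ (f x))) (∑-filter P? xs f)
  ... | no  _ = trans (∑-filter P? xs f) (sym (+-identityˡ _))

  ∑-enumeration : ∀ {P : Pred A ℓ} (P? : Decidable P) {xs ys : List A} f →
    Unique xs → (∀ x → x ∈ₗ xs ⇔ P x) → Unique ys → (∀ x → x ∈ₗ ys) →
    ∑ xs f ≡ ∑ ys (λ x → 𝟙 (P? x) * f x)
  ∑-enumeration P? {xs} {ys} f xs! xs⇔P ys! ∈ys =
    trans (∑-unique-⇔ f xs! (filter⁺ P? ys!) xs≈filter) (∑-filter P? ys f)
    where
    xs≈filter : ∀ {x} → x ∈ₗ xs ⇔ x ∈ₗ filter P? ys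
    xs≈filter {x} = mk⇔ (λ x∈xs → ∈-filter⁺ P? (∈ys x) (Equivalence.to (xs⇔P x) x∈xs))
                        (λ x∈filter → Equivalence.from (xs⇔P x) (proj₂ (∈-filter⁻ P? {xs = ys} x∈filter)))

  -- Subsets of Fin n

  vectors : List A → (n : ℕ) → List (Vec A n)
  vectors xs zero    = [ [] ]
  vectors xs (suc n) = cartesianProductWith _∷_ xs (vectors xs n)

  ∈-vectors : ∀ {xs : List A} → (∀ x → x ∈ₗ xs) → (v : Vec A n) → v ∈ₗ vectors xs n
  ∈-vectors ∈xs []       = here refl
  ∈-vectors ∈xs (x ∷ v) = ∈-cartesianProductWith⁺ _∷_ (∈xs x) (∈-vectors ∈xs v)

  vectors-unique : ∀ {xs : List A} → Unique xs → ∀ n → Unique (vectors xs n)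
  vectors-unique xs! zero    = [] ∷ []
  vectors-unique xs! (suc n) = cartesianProductWith⁺ _∷_ ∷-injective xs! (vectors-unique xs! n)

  subsets : (n : ℕ) → List (Subset n)
  subsets = vectors (outside ∷ inside ∷ [])

  ∈-subsets : (p : Subset n) → p ∈ₗ subsets n
  ∈-subsets = ∈-vectors λ { outside → here refl ; inside → there (here refl) }

  subsets-unique : ∀ n → Unique (subsets n)
  subsets-unique = vectors-unique (((λ ()) ∷ []) ∷ [] ∷ [])

  ∑-subsets-suc : ∀ n f →
    ∑ (subsets (suc n)) f ≡ ∑ (subsets n) (f ∘ (outside ∷_)) + ∑ (subsets n) (f ∘ (inside ∷_))
  ∑-subsets-suc n f = trans (∑-cartesianProductWith _∷_ (outside ∷ inside ∷ []) (subsets n) f)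
                            (cong (_+_ (∑ (subsets n) (f ∘ (outside ∷_)))) (+-identityʳ _))

  ∑-subsets-pow : ∀ n x → ∑ (subsets n) (λ p → x ^ ∣ p ∣) ≡ (x + + 1) ^ n
  ∑-subsets-pow zero    x = refl
  ∑-subsets-pow (suc n) x = begin
    ∑ (subsets (suc n)) (λ p → x ^ ∣ p ∣)               ≡⟨ ∑-subsets-suc n (λ p → x ^ ∣ p ∣) ⟩
    s + ∑ (subsets n) (λ p → x * x ^ ∣ p ∣)             ≡⟨ cong (_+_ s) (∑-*ˡ (subsets n) x (λ p → x ^ ∣ p ∣)) ⟩
    s + x * s                                          ≡⟨ cong (λ s → s + x * s) (∑-subsets-pow n x) ⟩
    (x + + 1) ^ n + x * (x + + 1) ^ n                  ≡⟨ factor x ((x + + 1) ^ n) ⟩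
    (x + + 1) ^ suc n                                  ∎
    where
    s : ℤ
    s = ∑ (subsets n) (λ p → x ^ ∣ p ∣)
    factor : ∀ x t → t + x * t ≡ (x + + 1) * t
    factor = solve-∀

  𝟙-true : {P : Set ℓ} → P → (P? : Dec P) → 𝟙 P? ≡ + 1
  𝟙-true P (yes _) = refl
  𝟙-true P (no ¬P) = contradiction P ¬P

  𝟙-false : {P : Set ℓ} → ¬ P → (P? : Dec P) → 𝟙 P? ≡ + 0
  𝟙-false ¬P (yes P) = contradiction P ¬P
  𝟙-false ¬P (no _)  = refl

  nonempty-outside∷ : {q : Subset n} → Nonempty (outside ∷ q) ⇔ Nonempty q
  nonempty-outside∷ = mk⇔ (λ { (suc x , there x∈q) → x , x∈q }) (λ (x , x∈q) → suc x , there x∈q)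

  ∑-subsets-split : ∀ n (f : Subset n → ℤ) →
    ∑ (subsets n) f ≡ f ⊥ + ∑ (subsets n) (λ q → 𝟙 (nonempty? q) * f q)
  ∑-subsets-split zero    f = cong (_+_ (f [])) (sym (+-identityʳ (+ 0)))
  ∑-subsets-split (suc n) f = begin
    ∑ (subsets (suc n)) f
      ≡⟨ ∑-subsets-suc n f ⟩
    ∑ (subsets n) (f ∘ (outside ∷_)) + ∑ (subsets n) (f ∘ (inside ∷_))
      ≡⟨ cong (_+ ∑ (subsets n) (f ∘ (inside ∷_))) (∑-subsets-split n (f ∘ (outside ∷_))) ⟩
    f ⊥ + ∑ (subsets n) (λ q → 𝟙 (nonempty? q) * f (outside ∷ q)) + ∑ (subsets n) (f ∘ (inside ∷_))
      ≡⟨ +-assoc (f ⊥) _ _ ⟩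
    f ⊥ + (∑ (subsets n) (λ q → 𝟙 (nonempty? q) * f (outside ∷ q)) + ∑ (subsets n) (f ∘ (inside ∷_)))
      ≡⟨ cong (_+_ (f ⊥)) (sym (cong₂ _+_ (∑-cong (subsets n) outside-weight) (∑-cong (subsets n) inside-weight))) ⟩
    f ⊥ + (∑ (subsets n) (λ q → 𝟙 (nonempty? (outside ∷ q)) * f (outside ∷ q))
            + ∑ (subsets n) (λ q → 𝟙 (nonempty? (inside ∷ q)) * f (inside ∷ q)))
      ≡⟨ cong (_+_ (f ⊥)) (sym (∑-subsets-suc n (λ q → 𝟙 (nonempty? q) * f q))) ⟩
    f ⊥ + ∑ (subsets (suc n)) (λ q → 𝟙 (nonempty? q) * f q) ∎
    where
    outside-weight : ∀ q → 𝟙 (nonempty? (outside ∷ q)) * f (outside ∷ q) ≡ 𝟙 (nonempty? q) * f (outside ∷ q)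
    outside-weight q = cong (_* f (outside ∷ q)) (𝟙-⇔ nonempty-outside∷ (nonempty? (outside ∷ q)) (nonempty? q))
    inside-weight : ∀ q → 𝟙 (nonempty? (inside ∷ q)) * f (inside ∷ q) ≡ f (inside ∷ q)
    inside-weight q = trans (cong (_* f (inside ∷ q)) (𝟙-true (zero , here) (nonempty? (inside ∷ q)))) (*-identityˡ _)

  nonempty⊥-false : ∀ n → does (nonempty? (⊥ {n})) ≡ false
  nonempty⊥-false n = dec-false (nonempty? (⊥ {n})) (λ (_ , x∈⊥) → ∉⊥ x∈⊥)

  ∑-subsets-byEmptiness : ∀ n (φ : Bool → Subset n → ℤ) →
    ∑ (subsets n) (λ q → φ (does (nonempty? q)) q) ≡ φ false ⊥ + ∑ (subsets n) (λ q → 𝟙 (nonempty? q) * φ true q)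
  ∑-subsets-byEmptiness n φ = begin
    ∑ (subsets n) (λ q → φ (does (nonempty? q)) q)
      ≡⟨ ∑-subsets-split n (λ q → φ (does (nonempty? q)) q) ⟩
    φ (does (nonempty? (⊥ {n}))) ⊥ + ∑ (subsets n) (λ q → 𝟙 (nonempty? q) * φ (does (nonempty? q)) q)
      ≡⟨ cong₂ _+_ (cong (λ b → φ b ⊥) (nonempty⊥-false n)) (∑-cong (subsets n) nonempty-case) ⟩
    φ false ⊥ + ∑ (subsets n) (λ q → 𝟙 (nonempty? q) * φ true q) ∎
    where
    nonempty-case : ∀ q → 𝟙 (nonempty? q) * φ (does (nonempty? q)) q ≡ 𝟙 (nonempty? q) * φ true q
    nonempty-case q with nonempty? q
    ... | yes _ = refl
    ... | no  _ = refl

  ∑-subsets-nonempty-pow : ∀ n x → ∑ (subsets n) (λ q → 𝟙 (nonempty? q) * x ^ ∣ q ∣) ≡ (x + + 1) ^ n - + 1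
  ∑-subsets-nonempty-pow n x = begin
    s                       ≡⟨ add-sub s ⟩
    x ^ 0 + s - + 1         ≡⟨ cong (λ k → x ^ k + s - + 1) (sym (∣⊥∣≡0 n)) ⟩
    x ^ ∣ ⊥ {n} ∣ + s - + 1 ≡⟨ cong (_- + 1) (sym (∑-subsets-split n (λ q → x ^ ∣ q ∣))) ⟩
    ∑ (subsets n) (λ q → x ^ ∣ q ∣) - + 1 ≡⟨ cong (_- + 1) (∑-subsets-pow n x) ⟩
    (x + + 1) ^ n - + 1     ∎
    where
    s : ℤ
    s = ∑ (subsets n) (λ q → 𝟙 (nonempty? q) * x ^ ∣ q ∣)
    add-sub : ∀ s → s ≡ + 1 + s - + 1
    add-sub = solve-∀

  ∑-subsets-pow-byEmptiness : ∀ n x (g : Bool → ℤ) →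
    ∑ (subsets n) (λ q → g (does (nonempty? q)) * x ^ ∣ q ∣) ≡ g false + ((x + + 1) ^ n - + 1) * g true
  ∑-subsets-pow-byEmptiness n x g = begin
    ∑ (subsets n) (λ q → g (does (nonempty? q)) * x ^ ∣ q ∣)
      ≡⟨ ∑-subsets-byEmptiness n (λ b q → g b * x ^ ∣ q ∣) ⟩
    g false * x ^ ∣ ⊥ {n} ∣ + ∑ (subsets n) (λ q → 𝟙 (nonempty? q) * (g true * x ^ ∣ q ∣))
      ≡⟨ cong₂ _+_ (trans (cong (λ k → g false * x ^ k) (∣⊥∣≡0 n)) (*-identityʳ (g false)))
                   (trans (∑-cong (subsets n) (λ q → left-comm (𝟙 (nonempty? q)) (g true) (x ^ ∣ q ∣)))
                          (∑-*ˡ (subsets n) (g true) (λ q → 𝟙 (nonempty? q) * x ^ ∣ q ∣))) ⟩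
    g false + g true * ∑ (subsets n) (λ q → 𝟙 (nonempty? q) * x ^ ∣ q ∣)
      ≡⟨ cong (λ t → g false + g true * t) (∑-subsets-nonempty-pow n x) ⟩
    g false + g true * ((x + + 1) ^ n - + 1)
      ≡⟨ cong (_+_ (g false)) (*-comm (g true) _) ⟩
    g false + ((x + + 1) ^ n - + 1) * g true ∎
    where
    left-comm : ∀ a b c → a * (b * c) ≡ b * (a * c)
    left-comm = solve-∀

  ∣p∣≢0⇒nonempty : ∀ {n} (p : Subset n) → ∣ p ∣ ≢ 0 → Nonempty p
  ∣p∣≢0⇒nonempty {n} p ∣p∣≢0 with nonempty? p
  ... | yes ne = ne
  ... | no ¬ne = contradiction (trans (cong ∣_∣ (Empty-unique ¬ne)) (∣⊥∣≡0 n)) ∣p∣≢0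

  ∣p∣≡0⇒x∉p : ∀ (p : Subset n) {x} → ∣ p ∣ ≡ 0 → x ∉ p
  ∣p∣≡0⇒x∉p (outside ∷ p) ∣p∣≡0 (there x∈p) = ∣p∣≡0⇒x∉p p ∣p∣≡0 x∈p

  ∣p∣≡1⇒sole : ∀ (p : Subset n) → ∣ p ∣ ≡ 1 → ∃[ u ] (u ∈ p × ∀ {w} → w ∈ p → w ≡ u)
  ∣p∣≡1⇒sole (inside ∷ p) ∣p∣≡1 = zero , here , λ
    { here        → refl
    ; (there w∈p) → contradiction w∈p (∣p∣≡0⇒x∉p p (ℕ.suc-injective ∣p∣≡1)) }
  ∣p∣≡1⇒sole (outside ∷ p) ∣p∣≡1 with ∣p∣≡1⇒sole p ∣p∣≡1
  ... | u , u∈p , sole = suc u , there u∈p , λ { (there w∈p) → cong suc (sole w∈p) }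

  ∣p∣≢1⇒other : ∀ (p : Subset n) {u} → ∣ p ∣ ≢ 1 → u ∈ p → ∃[ w ] (w ∈ p × w ≢ u)
  ∣p∣≢1⇒other (inside ∷ p) ∣p∣≢1 here with ∣p∣≢0⇒nonempty p (∣p∣≢1 ∘ cong suc)
  ... | w , w∈p = suc w , there w∈p , λ ()
  ∣p∣≢1⇒other (inside ∷ p) _ (there _) = zero , here , λ ()
  ∣p∣≢1⇒other (outside ∷ p) ∣p∣≢1 (there u∈p) with ∣p∣≢1⇒other p ∣p∣≢1 u∈p
  ... | w , w∈p , w≢u = suc w , there w∈p , w≢u ∘ suc-injective

  ∣p++q∣≡∣p∣+∣q∣ : ∀ (p : Subset m) (q : Subset n) → ∣ p ++ q ∣ ≡ ∣ p ∣ ℕ.+ ∣ q ∣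
  ∣p++q∣≡∣p∣+∣q∣ []            q = refl
  ∣p++q∣≡∣p∣+∣q∣ (outside ∷ p) q = ∣p++q∣≡∣p∣+∣q∣ p q
  ∣p++q∣≡∣p∣+∣q∣ (inside ∷ p)  q = cong suc (∣p++q∣≡∣p∣+∣q∣ p q)

  -- Families of fibres

  families : ∀ m k → List (Vec (Subset m) k)
  families m = vectors (subsets m)

  support : ∀ {k} → Vec (Subset m) k → Subset k
  support = Vec.map (does ∘ nonempty?)

  ∈-support : ∀ {m k} {F : Vec (Subset m) k} {u} → u ∈ support F ⇔ Nonempty (lookup F u)
  ∈-support {F = F} {u} = mk⇔
    (λ u∈ → invert (subst (Reflects _) (trans (sym (lookup-map u _ F)) ([]=⇒lookup u∈)) (proof (nonempty? (lookup F u)))))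
    (λ ne → lookup⇒[]= u (support F) (trans (lookup-map u _ F) (dec-true (nonempty? _) ne)))

  ∑-families-∷ : ∀ m x k (f : Vec (Subset m) (suc k) → ℤ) →
    ∑ (families m (suc k)) (λ F → f F * x ^ ∣ concat F ∣)
      ≡ ∑ (subsets m) (λ A → ∑ (families m k) (λ F → f (A ∷ F) * x ^ ∣ concat F ∣) * x ^ ∣ A ∣)
  ∑-families-∷ m x k f = trans (∑-cartesianProductWith _∷_ (subsets m) (families m k) _) (∑-cong (subsets m) split-weight)
    where
    regroup : ∀ a b c → a * (b * c) ≡ a * c * b
    regroup = solve-∀
    split-weight : ∀ A → ∑ (families m k) (λ F → f (A ∷ F) * x ^ ∣ A ++ concat F ∣)
                       ≡ ∑ (families m k) (λ F → f (A ∷ F) * x ^ ∣ concat F ∣) * x ^ ∣ A ∣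
    split-weight A = trans (∑-cong (families m k) λ F →
                             trans (cong (λ e → f (A ∷ F) * x ^ e) (∣p++q∣≡∣p∣+∣q∣ A (concat F)))
                            (trans (cong (_*_ (f (A ∷ F))) (^-distribˡ-+-* x ∣ A ∣ ∣ concat F ∣))
                                   (regroup (f (A ∷ F)) (x ^ ∣ A ∣) (x ^ ∣ concat F ∣))))
                           (∑-*ʳ (families m k) (x ^ ∣ A ∣) _)

  ∑-families-support : ∀ m x k (w : Subset k → ℤ) →
    ∑ (families m k) (λ F → w (support F) * x ^ ∣ concat F ∣)
      ≡ ∑ (subsets k) (λ T → w T * ((x + + 1) ^ m - + 1) ^ ∣ T ∣)
  ∑-families-support m x zero    w = refl
  ∑-families-support m x (suc k) w = begin
    ∑ (families m (suc k)) (λ F → w (support F) * x ^ ∣ concat F ∣)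
      ≡⟨ ∑-families-∷ m x k (w ∘ support) ⟩
    ∑ (subsets m) (λ A → G (does (nonempty? A)) * x ^ ∣ A ∣)
      ≡⟨ ∑-subsets-pow-byEmptiness m x G ⟩
    G false + y * G true
      ≡⟨ cong₂ (λ a b → a + y * b) (∑-families-support m x k (w ∘ (outside ∷_)))
                                    (∑-families-support m x k (w ∘ (inside ∷_))) ⟩
    ∑ (subsets k) (λ T → w (outside ∷ T) * y ^ ∣ T ∣) + y * ∑ (subsets k) (λ T → w (inside ∷ T) * y ^ ∣ T ∣)
      ≡⟨ cong (_+_ (∑ (subsets k) (λ T → w (outside ∷ T) * y ^ ∣ T ∣))) (sym inside-pow) ⟩
    ∑ (subsets k) (λ T → w (outside ∷ T) * y ^ ∣ T ∣) + ∑ (subsets k) (λ T → w (inside ∷ T) * y ^ suc ∣ T ∣)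
      ≡⟨ sym (∑-subsets-suc k (λ T → w T * y ^ ∣ T ∣)) ⟩
    ∑ (subsets (suc k)) (λ T → w T * y ^ ∣ T ∣) ∎
    where
    y : ℤ
    y = (x + + 1) ^ m - + 1
    G : Bool → ℤ
    G b = ∑ (families m k) (λ F → w (b ∷ support F) * x ^ ∣ concat F ∣)
    left-comm : ∀ a b c → a * (b * c) ≡ b * (a * c)
    left-comm = solve-∀
    inside-pow : ∑ (subsets k) (λ T → w (inside ∷ T) * y ^ suc ∣ T ∣) ≡ y * ∑ (subsets k) (λ T → w (inside ∷ T) * y ^ ∣ T ∣)
    inside-pow = trans (∑-cong (subsets k) (λ T → left-comm (w (inside ∷ T)) y (y ^ ∣ T ∣)))
                       (∑-*ˡ (subsets k) y (λ T → w (inside ∷ T) * y ^ ∣ T ∣))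

  -- h of the only nonempty fibre of F, and 0 unless exactly one fibre is nonempty.
  soleFibre : ∀ {k} → (Subset m → ℤ) → Vec (Subset m) k → ℤ
  soleFibre h []      = + 0
  soleFibre h (A ∷ F) = if does (nonempty? A) then h A * 𝟙 (¬? (nonempty? (support F))) else soleFibre h F

  soleFibre-sole : ∀ {m k} (h : Subset m → ℤ) (F : Vec (Subset m) k) {u} →
    u ∈ support F → (∀ {w} → w ∈ support F → w ≡ u) → soleFibre h F ≡ h (lookup F u)
  soleFibre-sole h (A ∷ F) u∈T sole with nonempty? A
  soleFibre-sole h (A ∷ F) {zero}  u∈T sole | yes _ =
    trans (cong (_*_ (h A)) (𝟙-true (λ (w , w∈T) → contradiction (sole (there w∈T)) λ ()) (¬? (nonempty? (support F)))))
          (*-identityʳ (h A))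
  soleFibre-sole h (A ∷ F) {suc u} u∈T sole | yes _ = contradiction (sole here) λ ()
  soleFibre-sole h (A ∷ F) {suc u} u∈T sole | no _  =
    soleFibre-sole h F (drop-there u∈T) (λ w∈T → suc-injective (sole (there w∈T)))

  soleFibre-≢1 : ∀ {m k} (h : Subset m → ℤ) (F : Vec (Subset m) k) → ∣ support F ∣ ≢ 1 → soleFibre h F ≡ + 0
  soleFibre-≢1 h []      _     = refl
  soleFibre-≢1 h (A ∷ F) ∣T∣≢1 with nonempty? A
  ... | yes _ = trans (cong (_*_ (h A)) (𝟙-false (λ empty → empty nonempty-support) (¬? (nonempty? (support F)))))
                      (*-zeroʳ (h A))
    where
    nonempty-support : Nonempty (support F)
    nonempty-support = ∣p∣≢0⇒nonempty (support F) (λ ∣T∣≡0 → ∣T∣≢1 (cong suc ∣T∣≡0))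
  ... | no  _ = soleFibre-≢1 h F ∣T∣≢1

  ∑-families-emptySupport : ∀ m x k →
    ∑ (families m k) (λ F → 𝟙 (¬? (nonempty? (support F))) * x ^ ∣ concat F ∣) ≡ + 1
  ∑-families-emptySupport m x k = begin
    ∑ (families m k) (λ F → 𝟙 (¬? (nonempty? (support F))) * x ^ ∣ concat F ∣)
      ≡⟨ ∑-families-support m x k (λ T → 𝟙 (¬? (nonempty? T))) ⟩
    ∑ (subsets k) (λ T → 𝟙 (¬? (nonempty? T)) * y ^ ∣ T ∣)
      ≡⟨ ∑-subsets-pow-byEmptiness k y (λ b → if not b then + 1 else + 0) ⟩
    + 1 + ((y + + 1) ^ k - + 1) * + 0
      ≡⟨ cong (_+_ (+ 1)) (*-zeroʳ ((y + + 1) ^ k - + 1)) ⟩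
    + 1 ∎
    where
    y : ℤ
    y = (x + + 1) ^ m - + 1

  ∑-families-soleFibre : ∀ m x k (h : Subset m → ℤ) →
    ∑ (families m k) (λ F → soleFibre h F * x ^ ∣ concat F ∣)
      ≡ + k * ∑ (subsets m) (λ A → 𝟙 (nonempty? A) * (h A * x ^ ∣ A ∣))
  ∑-families-soleFibre m x zero    h = refl
  ∑-families-soleFibre m x (suc k) h = begin
    ∑ (families m (suc k)) (λ F → soleFibre h F * x ^ ∣ concat F ∣)
      ≡⟨ ∑-families-∷ m x k (soleFibre h) ⟩
    ∑ (subsets m) (λ A → Φ (does (nonempty? A)) A * x ^ ∣ A ∣)
      ≡⟨ ∑-subsets-byEmptiness m (λ b A → Φ b A * x ^ ∣ A ∣) ⟩
    R * x ^ ∣ ⊥ {m} ∣ + ∑ (subsets m) (λ A → 𝟙 (nonempty? A) * (Φ true A * x ^ ∣ A ∣))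
      ≡⟨ cong₂ _+_ (trans (cong (λ e → R * x ^ e) (∣⊥∣≡0 m)) (*-identityʳ R))
                   (∑-cong (subsets m) λ A → cong (λ z → 𝟙 (nonempty? A) * (z * x ^ ∣ A ∣)) (Φ-nonempty A)) ⟩
    R + Q
      ≡⟨ cong (_+ Q) (∑-families-soleFibre m x k h) ⟩
    + k * Q + Q
      ≡⟨ add-one (+ k) Q ⟩
    + suc k * Q ∎
    where
    Φ : Bool → Subset m → ℤ
    Φ b A = ∑ (families m k) λ F →
      (if b then h A * 𝟙 (¬? (nonempty? (support F))) else soleFibre h F) * x ^ ∣ concat F ∣
    R : ℤ
    R = ∑ (families m k) (λ F → soleFibre h F * x ^ ∣ concat F ∣)
    Q : ℤ
    Q = ∑ (subsets m) (λ A → 𝟙 (nonempty? A) * (h A * x ^ ∣ A ∣))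
    Φ-nonempty : ∀ A → Φ true A ≡ h A
    Φ-nonempty A = begin
      Φ true A
        ≡⟨ ∑-cong (families m k) (λ F → *-assoc (h A) _ _) ⟩
      ∑ (families m k) (λ F → h A * (𝟙 (¬? (nonempty? (support F))) * x ^ ∣ concat F ∣))
        ≡⟨ ∑-*ˡ (families m k) (h A) _ ⟩
      h A * ∑ (families m k) (λ F → 𝟙 (¬? (nonempty? (support F))) * x ^ ∣ concat F ∣)
        ≡⟨ cong (_*_ (h A)) (∑-families-emptySupport m x k) ⟩
      h A * + 1
        ≡⟨ *-identityʳ (h A) ⟩
      h A ∎
    add-one : ∀ k q → k * q + q ≡ (+ 1 + k) * q
    add-one = solve-∀

  concat-injective : ∀ {k} (F F′ : Vec (Vec A m) k) → concat F ≡ concat F′ → F ≡ F′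
  concat-injective []      []        _  = refl
  concat-injective (A ∷ F) (A′ ∷ F′) eq =
    cong₂ _∷_ (++-injectiveˡ A A′ eq) (concat-injective F F′ (++-injectiveʳ A A′ eq))

  ∑-subsets-concat : ∀ k m f → ∑ (subsets (k ℕ.* m)) f ≡ ∑ (families m k) (f ∘ concat)
  ∑-subsets-concat k m f = begin
    ∑ (subsets (k ℕ.* m)) f
      ≡⟨ ∑-unique-⇔ f (subsets-unique (k ℕ.* m)) concats-unique (mk⇔ ∈-concats (λ _ → ∈-subsets _)) ⟩
    ∑ (map concat (families m k)) f
      ≡⟨ ∑-map concat (families m k) f ⟩
    ∑ (families m k) (f ∘ concat) ∎
    where
    concats-unique : Unique (map concat (families m k))
    concats-unique = map⁺ (concat-injective _ _) (vectors-unique (subsets-unique m) k)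
    ∈-concats : ∀ {S} → S ∈ₗ subsets (k ℕ.* m) → S ∈ₗ map concat (families m k)
    ∈-concats {S} _ with group k m S
    ... | F , refl = ∈-map⁺ concat (∈-vectors ∈-subsets F)

  -- Connected sets of a lexicographic product

  module _ {A : Adj n} {S : Subset n} where

    Reach-trans : ∀ {u v w} → Reach A S u v → Reach A S v w → Reach A S u w
    Reach-trans u⇝v (here _)          = u⇝v
    Reach-trans u⇝v (step v⇝w e w∈S) = step (Reach-trans u⇝v v⇝w) e w∈S

    Reach-∈ʳ : ∀ {u v} → Reach A S u v → v ∈ S
    Reach-∈ʳ (here v∈S)     = v∈S
    Reach-∈ʳ (step _ _ v∈S) = v∈S

    sole-connected : ∀ {u} → u ∈ S → (∀ {w} → w ∈ S → w ≡ u) → Connected A S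
    sole-connected u∈S sole = (_ , u∈S) , λ v w v∈S w∈S →
      subst₂ (Reach A S) (sym (sole v∈S)) (sym (sole w∈S)) (here u∈S)

  module LexProduct {nG nH : ℕ} (G : Adj nG) (H : Adj nH) where

    block : Fin (nG ℕ.* nH) → Fin nG
    block p = proj₁ (remQuot {nG} nH p)

    offset : Fin (nG ℕ.* nH) → Fin nH
    offset p = proj₂ (remQuot {nG} nH p)

    lex-≡ : ∀ p q → lex G H p q ≡ (G (block p) (block q) ∨ (⌊ block p ≟ block q ⌋ ∧ H (offset p) (offset q)))
    lex-≡ p q with remQuot {nG} nH p | remQuot {nG} nH q
    ... | _ | _ = refl

    lex-edge⁻ : ∀ {p q} → lex G H p q ≡ true →
                G (block p) (block q) ≡ true ⊎ (block p ≡ block q × H (offset p) (offset q) ≡ true)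
    lex-edge⁻ {p} {q} e with G (block p) (block q) | block p ≟ block q | trans (sym (lex-≡ p q)) e
    ... | true  | _        | _ = inj₁ refl
    ... | false | yes p≡q | e′ = inj₂ (p≡q , e′)
    ... | false | no  _   | ()

    lex-edgeᴳ : ∀ {p q} → G (block p) (block q) ≡ true → lex G H p q ≡ true
    lex-edgeᴳ {p} {q} e = trans (lex-≡ p q) (cong (_∨ (⌊ block p ≟ block q ⌋ ∧ H (offset p) (offset q))) e)

    block-combine : ∀ u x → block (combine u x) ≡ u
    block-combine u x = cong proj₁ (remQuot-combine {nG} {nH} u x)

    offset-combine : ∀ u x → offset (combine u x) ≡ x
    offset-combine u x = cong proj₂ (remQuot-combine {nG} {nH} u x)

    lex-edgeᴴ : ∀ {u x y} → H x y ≡ true → lex G H (combine u x) (combine u y) ≡ true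
    lex-edgeᴴ {u} {x} {y} e = trans (lex-≡ (combine u x) (combine u y))
      (edge (block-combine u x) (block-combine u y) (offset-combine u x) (offset-combine u y))
      where
      edge : ∀ {v w x′ y′} → v ≡ u → w ≡ u → x′ ≡ x → y′ ≡ y → (G v w ∨ (⌊ v ≟ w ⌋ ∧ H x′ y′)) ≡ true
      edge refl refl refl refl with u ≟ u
      ... | yes _   = trans (cong (λ b → G u u ∨ b) e) (∨-zeroʳ (G u u))
      ... | no u≢u = contradiction refl u≢u

    module _ (F : Vec (Subset nH) nG) where

      ∈-concat⁺ : ∀ {u x} → x ∈ lookup F u → combine u x ∈ concat F
      ∈-concat⁺ {u} {x} x∈F = lookup⇒[]= _ (concat F) (trans (lookup-concat F u x) ([]=⇒lookup x∈F))

      ∈-concat⁻ : ∀ {p} → p ∈ concat F → offset p ∈ lookup F (block p)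
      ∈-concat⁻ {p} p∈S = lookup⇒[]= _ (lookup F (block p))
        (trans (sym (lookup-concat F (block p) (offset p)))
               (trans (cong (lookup (concat F)) (combine-remQuot {nG} nH p)) ([]=⇒lookup p∈S)))

      block-∈ : ∀ {p} → p ∈ concat F → block p ∈ support F
      block-∈ p∈S = Equivalence.from ∈-support (_ , ∈-concat⁻ p∈S)

      block⁻¹ : ∀ {u} → u ∈ support F → ∃[ p ] (p ∈ concat F × block p ≡ u)
      block⁻¹ {u} u∈T with Equivalence.to ∈-support u∈T
      ... | x , x∈F = combine u x , ∈-concat⁺ x∈F , block-combine u x

      reach-block : ∀ {p q} → Reach (lex G H) (concat F) p q → Reach G (support F) (block p) (block q)
      reach-block (here p∈S) = here (block-∈ p∈S)
      reach-block (step p⇝v e w∈S) with lex-edge⁻ e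
      ... | inj₁ g             = step (reach-block p⇝v) g (block-∈ w∈S)
      ... | inj₂ (v≡w , _)     = subst (Reach G (support F) _) v≡w (reach-block p⇝v)

      connected-support : Connected (lex G H) (concat F) → Connected G (support F)
      connected-support ((p , p∈S) , reach) = (block p , block-∈ p∈S) , λ u v u∈T v∈T →
        let (p′ , p′∈S , p′↦u) = block⁻¹ u∈T
            (q′ , q′∈S , q′↦v) = block⁻¹ v∈T
        in subst₂ (Reach G (support F)) p′↦u q′↦v (reach-block (reach p′ q′ p′∈S q′∈S))

      -- The last step of the walk is a G-edge, which lifts to an edge into any node over its end.
      reach-lift : ∀ {a b} → Reach G (support F) a b → a ≢ b → ∀ {p q} → p ∈ concat F → q ∈ concat F →
                   block p ≡ a → block q ≡ b → Reach (lex G H) (concat F) p q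
      reach-lift (here _) a≢a _ _ _ _ = contradiction refl a≢a
      reach-lift {a} (step {v} a⇝v e _) a≢b {p} {q} p∈S q∈S p↦a refl with a ≟ v
      ... | yes refl = step (here p∈S) (lex-edgeᴳ (subst (λ c → G c (block q) ≡ true) (sym p↦a) e)) q∈S
      ... | no a≢v with block⁻¹ (Reach-∈ʳ a⇝v)
      ...   | r , r∈S , r↦v = step (reach-lift a⇝v a≢v p∈S r∈S p↦a r↦v)
                                   (lex-edgeᴳ (subst (λ c → G c (block q) ≡ true) (sym r↦v) e)) q∈S

      connected-concat : ∣ support F ∣ ≢ 1 → Connected G (support F) → Connected (lex G H) (concat F)
      connected-concat ∣T∣≢1 ((u , u∈T) , reach) = nonempty , λ p q p∈S q∈S → reach-concat p∈S q∈S
        where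
        nonempty : Nonempty (concat F)
        nonempty = let (p , p∈S , _) = block⁻¹ u∈T in p , p∈S
        reach-concat : ∀ {p q} → p ∈ concat F → q ∈ concat F → Reach (lex G H) (concat F) p q
        -- Two nodes over the same block are joined through a node over another block.
        reach-concat {p} {q} p∈S q∈S with block p ≟ block q
        ... | no p≢q = reach-lift (reach _ _ (block-∈ p∈S) (block-∈ q∈S)) p≢q p∈S q∈S refl refl
        ... | yes p≡q with ∣p∣≢1⇒other (support F) ∣T∣≢1 (block-∈ p∈S)
        ...   | w , w∈T , w≢p with block⁻¹ w∈T
        ...     | r , r∈S , r↦w =
          Reach-trans (reach-lift (reach _ _ (block-∈ p∈S) w∈T) (w≢p ∘ sym) p∈S r∈S refl r↦w)
                      (reach-lift (reach _ _ w∈T (block-∈ q∈S)) (λ w≡q → w≢p (trans w≡q (sym p≡q))) r∈S q∈S r↦w refl)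

      module _ (loopless : ∀ v → G v v ≡ false) {u} (sole : ∀ {w} → w ∈ support F → w ≡ u) where

        offset-∈ : ∀ {p} → p ∈ concat F → offset p ∈ lookup F u
        offset-∈ {p} p∈S = subst (λ v → offset p ∈ lookup F v) (sole (block-∈ p∈S)) (∈-concat⁻ p∈S)

        reach-offset : ∀ {p q} → Reach (lex G H) (concat F) p q → Reach H (lookup F u) (offset p) (offset q)
        reach-offset (here p∈S) = here (offset-∈ p∈S)
        reach-offset (step {v} {w} p⇝v e w∈S) with lex-edge⁻ e
        ... | inj₂ (_ , h) = step (reach-offset p⇝v) h (offset-∈ w∈S)
        ... | inj₁ g       =
          contradiction (trans (sym g) (subst₂ (λ a b → G a b ≡ false) (sym v↦u) (sym w↦u) (loopless u))) λ ()
          where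
          v↦u : block v ≡ u
          v↦u = sole (block-∈ (Reach-∈ʳ p⇝v))
          w↦u : block w ≡ u
          w↦u = sole (block-∈ w∈S)

        reach-combine : ∀ {x y} → Reach H (lookup F u) x y → Reach (lex G H) (concat F) (combine u x) (combine u y)
        reach-combine (here x∈F)         = here (∈-concat⁺ x∈F)
        reach-combine (step x⇝y h z∈F) = step (reach-combine x⇝y) (lex-edgeᴴ h) (∈-concat⁺ z∈F)

        connected-concat⇔fibre : Connected (lex G H) (concat F) ⇔ Connected H (lookup F u)
        connected-concat⇔fibre = mk⇔
          (λ ((p , p∈S) , reach) → (offset p , offset-∈ p∈S) , λ x y x∈F y∈F →
             subst₂ (Reach H (lookup F u)) (offset-combine u x) (offset-combine u y)
                    (reach-offset (reach _ _ (∈-concat⁺ x∈F) (∈-concat⁺ y∈F))))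
          (λ ((x , x∈F) , reach) → (combine u x , ∈-concat⁺ x∈F) , λ p q p∈S q∈S →
             subst₂ (Reach (lex G H) (concat F)) (combine-offset p∈S) (combine-offset q∈S)
                    (reach-combine (reach _ _ (offset-∈ p∈S) (offset-∈ q∈S))))
          where
          combine-offset : ∀ {p} → p ∈ concat F → combine u (offset p) ≡ p
          combine-offset {p} p∈S = trans (cong (λ v → combine v (offset p)) (sym (sole (block-∈ p∈S))))
                                         (combine-remQuot {nG} nH p)

  -- The connected set polynomial

  -- C(A; x), read off a decision procedure for connectivity rather than an enumeration, so that
  -- K n needs no enumeration of its connected sets.
  connectedSetPoly : ∀ {n} {A : Adj n} → Decidable (Connected A) → ℤ → ℤ
  connectedSetPoly {n} A? x = ∑ (subsets n) (λ S → 𝟙 (A? S) * x ^ ∣ S ∣)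

  connectedSetPoly-nonempty : ∀ {n} {A : Adj n} (A? : Decidable (Connected A)) x →
    ∑ (subsets n) (λ S → 𝟙 (nonempty? S) * (𝟙 (A? S) * x ^ ∣ S ∣)) ≡ connectedSetPoly A? x
  connectedSetPoly-nonempty {n} A? x = ∑-cong (subsets n) nonempty-weight
    where
    nonempty-weight : ∀ S → 𝟙 (nonempty? S) * (𝟙 (A? S) * x ^ ∣ S ∣) ≡ 𝟙 (A? S) * x ^ ∣ S ∣
    nonempty-weight S with nonempty? S
    ... | yes _     = *-identityˡ _
    ... | no  empty = cong (_* x ^ ∣ S ∣) (sym (𝟙-false (λ (nonempty , _) → empty nonempty) (A? S)))

  module _ {nG nH : ℕ} {G : Adj nG} {H : Adj nH} (loopless : ∀ v → G v v ≡ false)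
           (G? : Decidable (Connected G)) (H? : Decidable (Connected H)) (GH? : Decidable (Connected (lex G H))) where

    open LexProduct G H

    𝟙-connected-lex : ∀ F → 𝟙 (GH? (concat F)) + soleFibre (λ _ → + 1) F
                          ≡ 𝟙 (G? (support F)) + soleFibre (𝟙 ∘ H?) F
    𝟙-connected-lex F with ∣ support F ∣ ℕ.≟ 1
    ... | no ∣T∣≢1 = cong₂ _+_ (𝟙-⇔ (mk⇔ (connected-support F) (connected-concat F ∣T∣≢1)) (GH? _) (G? _))
                               (trans (soleFibre-≢1 _ F ∣T∣≢1) (sym (soleFibre-≢1 _ F ∣T∣≢1)))
    ... | yes ∣T∣≡1 with ∣p∣≡1⇒sole (support F) ∣T∣≡1
    ...   | u , u∈T , sole = begin
      𝟙 (GH? (concat F)) + soleFibre (λ _ → + 1) F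
        ≡⟨ cong₂ _+_ (𝟙-⇔ (connected-concat⇔fibre F loopless sole) (GH? _) (H? _)) (soleFibre-sole _ F u∈T sole) ⟩
      𝟙 (H? (lookup F u)) + + 1
        ≡⟨ +-comm (𝟙 (H? (lookup F u))) (+ 1) ⟩
      + 1 + 𝟙 (H? (lookup F u))
        ≡⟨ sym (cong₂ _+_ (𝟙-true (sole-connected u∈T sole) (G? _)) (soleFibre-sole _ F u∈T sole)) ⟩
      𝟙 (G? (support F)) + soleFibre (𝟙 ∘ H?) F ∎

    -- The identity with n_G · ((x + 1)^n_H − 1) moved to the left, so that both sides are sums over families.
    connectedSetPoly-lex-balanced : ∀ x →
      connectedSetPoly GH? x + + nG * ((x + + 1) ^ nH - + 1)
        ≡ connectedSetPoly G? ((x + + 1) ^ nH - + 1) + + nG * connectedSetPoly H? x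
    connectedSetPoly-lex-balanced x = begin
      connectedSetPoly GH? x + + nG * y
        ≡⟨ cong₂ _+_ (∑-subsets-concat nG nH _) (sym soleFibre-one) ⟩
      ∑ (families nH nG) (λ F → 𝟙 (GH? (concat F)) * w F) + ∑ (families nH nG) (λ F → soleFibre (λ _ → + 1) F * w F)
        ≡⟨ sym (∑-+ (families nH nG) _ _) ⟩
      ∑ (families nH nG) (λ F → 𝟙 (GH? (concat F)) * w F + soleFibre (λ _ → + 1) F * w F)
        ≡⟨ trans (∑-cong (families nH nG) pointwise) (∑-+ (families nH nG) _ _) ⟩
      ∑ (families nH nG) (λ F → 𝟙 (G? (support F)) * w F) + ∑ (families nH nG) (λ F → soleFibre (𝟙 ∘ H?) F * w F)
        ≡⟨ cong₂ _+_ (∑-families-support nH x nG (𝟙 ∘ G?))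
                     (trans (∑-families-soleFibre nH x nG (𝟙 ∘ H?)) (cong (+ nG *_) (connectedSetPoly-nonempty H? x))) ⟩
      connectedSetPoly G? y + + nG * connectedSetPoly H? x ∎
      where
      y : ℤ
      y = (x + + 1) ^ nH - + 1
      w : Vec (Subset nH) nG → ℤ
      w F = x ^ ∣ concat F ∣
      soleFibre-one : ∑ (families nH nG) (λ F → soleFibre (λ _ → + 1) F * w F) ≡ + nG * y
      soleFibre-one = trans (∑-families-soleFibre nH x nG (λ _ → + 1))
                            (cong (+ nG *_) (trans (∑-cong (subsets nH) λ A → cong (𝟙 (nonempty? A) *_) (*-identityˡ _))
                                                   (∑-subsets-nonempty-pow nH x)))
      pointwise : ∀ F → 𝟙 (GH? (concat F)) * w F + soleFibre (λ _ → + 1) F * w F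
                      ≡ 𝟙 (G? (support F)) * w F + soleFibre (𝟙 ∘ H?) F * w F
      pointwise F = trans (sym (*-distribʳ-+ (w F) (𝟙 (GH? (concat F))) (soleFibre (λ _ → + 1) F)))
                          (trans (cong (_* w F) (𝟙-connected-lex F))
                                 (*-distribʳ-+ (w F) (𝟙 (G? (support F))) (soleFibre (𝟙 ∘ H?) F)))

    connectedSetPoly-lex : ∀ x → connectedSetPoly GH? x ≡
      connectedSetPoly G? ((x + + 1) ^ nH - + 1) + + nG * (connectedSetPoly H? x - (x + + 1) ^ nH + + 1)
    connectedSetPoly-lex x = begin
      connectedSetPoly GH? x                                            ≡⟨ add-sub (connectedSetPoly GH? x) (+ nG * y) ⟩
      connectedSetPoly GH? x + + nG * y - + nG * y                      ≡⟨ cong (_- + nG * y) (connectedSetPoly-lex-balanced x) ⟩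
      connectedSetPoly G? y + + nG * connectedSetPoly H? x - + nG * y
        ≡⟨ regroup (connectedSetPoly G? y) (+ nG) (connectedSetPoly H? x) ((x + + 1) ^ nH) ⟩
      connectedSetPoly G? y + + nG * (connectedSetPoly H? x - (x + + 1) ^ nH + + 1) ∎
      where
      y : ℤ
      y = (x + + 1) ^ nH - + 1
      add-sub : ∀ a b → a ≡ a + b - b
      add-sub = solve-∀
      regroup : ∀ g n h p → g + n * h - n * (p - + 1) ≡ g + n * (h - p + + 1)
      regroup = solve-∀

  CP≡∑ : ∀ {n} (L : List (Subset n)) x → CP L x ≡ ∑ L (λ S → x ^ ∣ S ∣)
  CP≡∑ []      x = refl
  CP≡∑ (S ∷ L) x = cong (_+_ (x ^ ∣ S ∣)) (CP≡∑ L x)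

  connected? : ∀ {n} {A : Adj n} {L} → EnumConnected A L → Decidable (Connected A)
  connected? {L = L} (_ , L⇔connected) S = Dec.map (L⇔connected S) (any? (≡-dec Bool._≟_ S) L)

  CP≡connectedSetPoly : ∀ {n} {A : Adj n} {L} → EnumConnected A L → (A? : Decidable (Connected A)) → ∀ x →
    CP L x ≡ connectedSetPoly A? x
  CP≡connectedSetPoly {n} {L = L} (L! , L⇔connected) A? x =
    trans (CP≡∑ L x) (∑-enumeration A? _ L! L⇔connected (subsets-unique n) ∈-subsets)

  K-edge : ∀ {n} {u v : Fin n} → u ≢ v → K n u v ≡ true
  K-edge {u = u} {v} u≢v with u ≟ v
  ... | yes u≡v = contradiction u≡v u≢v
  ... | no  _   = refl

  connected-K⇔nonempty : ∀ {n} {S : Subset n} → Connected (K n) S ⇔ Nonempty S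
  connected-K⇔nonempty {n} {S} = mk⇔ proj₁ (_, reach)
    where
    reach : ∀ u v → u ∈ S → v ∈ S → Reach (K n) S u v
    reach u v u∈S v∈S with u ≟ v
    ... | yes refl = here u∈S
    ... | no  u≢v  = step (here u∈S) (K-edge u≢v) v∈S

  connected-K? : ∀ n → Decidable (Connected (K n))
  connected-K? n S = Dec.map′ (Equivalence.from connected-K⇔nonempty) proj₁ (nonempty? S)

  connectedSetPoly-K : ∀ n x → connectedSetPoly (connected-K? n) x ≡ (x + + 1) ^ n - + 1
  connectedSetPoly-K n x = ∑-subsets-nonempty-pow n x

  module _ {nG nH : ℕ} {G : Adj nG} {LG : List (Subset nG)} (loopless : ∀ v → G v v ≡ false)
           (enumG : EnumConnected G LG) where


    CP-lex : ∀ {H : Adj nH} {LH LGH} → EnumConnected H LH → EnumConnected (lex G H) LGH → ∀ x →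
      CP LGH x ≡ CP LG ((x + + 1) ^ nH - + 1) + + nG * (CP LH x - (x + + 1) ^ nH + + 1)
    CP-lex {LH = LH} {LGH} enumH enumGH x = begin
      CP LGH x
        ≡⟨ CP≡connectedSetPoly enumGH (connected? enumGH) x ⟩
      connectedSetPoly (connected? enumGH) x
        ≡⟨ connectedSetPoly-lex loopless (connected? enumG) (connected? enumH) (connected? enumGH) x ⟩
      connectedSetPoly (connected? enumG) y + + nG * (connectedSetPoly (connected? enumH) x - (x + + 1) ^ nH + + 1)
        ≡⟨ sym (cong₂ (λ g h → g + + nG * (h - (x + + 1) ^ nH + + 1))
                      (CP≡connectedSetPoly enumG (connected? enumG) y) (CP≡connectedSetPoly enumH (connected? enumH) x)) ⟩
      CP LG y + + nG * (CP LH x - (x + + 1) ^ nH + + 1) ∎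
      where
      y : ℤ
      y = (x + + 1) ^ nH - + 1

    CP-lex-K : ∀ {LGK} → EnumConnected (lex G (K nH)) LGK → ∀ x → CP LGK x ≡ CP LG ((x + + 1) ^ nH - + 1)
    CP-lex-K {LGK} enumGK x = begin
      CP LGK x
        ≡⟨ CP≡connectedSetPoly enumGK (connected? enumGK) x ⟩
      connectedSetPoly (connected? enumGK) x
        ≡⟨ connectedSetPoly-lex loopless (connected? enumG) (connected-K? nH) (connected? enumGK) x ⟩
      connectedSetPoly (connected? enumG) y + + nG * (connectedSetPoly (connected-K? nH) x - (x + + 1) ^ nH + + 1)
        ≡⟨ cong (λ k → connectedSetPoly (connected? enumG) y + + nG * (k - (x + + 1) ^ nH + + 1)) (connectedSetPoly-K nH x) ⟩
      connectedSetPoly (connected? enumG) y + + nG * (y - (x + + 1) ^ nH + + 1)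
        ≡⟨ cancel (connectedSetPoly (connected? enumG) y) (+ nG) ((x + + 1) ^ nH) ⟩
      connectedSetPoly (connected? enumG) y
        ≡⟨ sym (CP≡connectedSetPoly enumG (connected? enumG) y) ⟩
      CP LG y ∎
      where
      y : ℤ
      y = (x + + 1) ^ nH - + 1
      cancel : ∀ c n p → c + n * (p - + 1 - p + + 1) ≡ c
      cancel = solve-∀

open import Defs
open import Data.Nat using (ℕ; _≤_; _*_)
open import Data.Integer using (ℤ; +_; _+_; _-_; _^_)
open import Data.Product using (_×_; _,_)
open import Data.List using (List)
open import Data.Fin.Subset using (Subset)
open import Relation.Binary.PropositionalEquality using (_≡_)
open ConnectedSetPolynomial using (CP-lex; CP-lex-K)

lemma7 : (∀ (nG nH : ℕ) (G : Adj nG) (H : Adj nH) → IsSimple G → IsSimple H →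
    (LG : List (Subset nG)) (LH : List (Subset nH)) (LGH : List (Subset (nG * nH))) →
    EnumConnected G LG → EnumConnected H LH → EnumConnected (lex G H) LGH →
    ∀ (x : ℤ) →
    CP LGH x ≡ CP LG ((x + + 1) ^ nH - + 1) + (+ nG) Data.Integer.* (CP LH x - (x + + 1) ^ nH + + 1))
    × (∀ (nG n : ℕ) → 1 ≤ n → (G : Adj nG) → IsSimple G →
    (LG : List (Subset nG)) (LGK : List (Subset (nG * n))) →
    EnumConnected G LG → EnumConnected (lex G (K n)) LGK →
    ∀ (x : ℤ) →
    CP LGK x ≡ CP LG ((x + + 1) ^ n - + 1))
lemma7 = (λ _ _ _ _ (_ , loopless) _ _ _ _ enumG enumH enumGH → CP-lex loopless enumG enumH enumGH)
       , (λ _ _ _ _ (_ , loopless) _ _ enumG enumGK → CP-lex-K loopless enumG enumGK)
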